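{- For every base $\mathscr B$, finite multisets of atoms $S,T$ and IMLL formula $\chi$: if $\Vdash^{S}_{\mathscr B}\mathrm I$ and $\Vdash^{T}_{\mathscr B}\chi$, then $\Vdash^{S,T}_{\mathscr B}\chi$.
   Context: Fix a countably infinite set $\mathbb{A}$ of atoms. IMLL formulas: $\phi::=p\in\mathbb A\mid\phi\otimes\phi\mid\mathrm I\mid\phi\multimap\phi$. $\Gamma,\Delta$ denote finite multisets of formulas, $P,S,T,U,V$ finite multisets of atoms, "$\Gamma,\Delta$" multiset union. An atomic rule is $(P_1\triangleright p_1,\dots,P_n\triangleright p_n)\Rightarrow p$ ($n\ge0$, $P_i$ finite multisets of atoms, $p_i,p$ atoms). A base is a (possibly infinite) set of atomic rules; $\mathscr C\supseteq\mathscr B$ means extension. Derivability $P\vdash_{\mathscr B}q$ is the least relation with: $[p]\vdash_{\mathscr B}p$ for every atom $p$; if $(P_1\triangleright p_1,\dots,P_n\triangleright p_n)\Rightarrow p\in\mathscr B$ and $S_i,P_i\vdash_{\mathscr B}p_i$ for $i=1,\dots,n$, then $S_1,\dots,S_n\vdash_{\mathscr B}p$. Support is defined inductively: $\Vdash^P_{\mathscr B}p$ iff $P\vdash_{\mathscr B}p$; $\Vdash^P_{\mathscr B}\phi\otimes\psi$ iff for every $\mathscr X\supseteq\mathscr B$, every $U$ and every atom $p$, if $\phi,\psi\Vdash^U_{\mathscr X}p$ then $\Vdash^{P,U}_{\mathscr X}p$; $\Vdash^P_{\mathscr B}\mathrm I$ iff for every $\mathscr X\supseteq\mathscr B$, $U$,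 atom $p$, if $\Vdash^U_{\mathscr X}p$ then $\Vdash^{P,U}_{\mathscr X}p$; $\Vdash^P_{\mathscr B}\phi\multimap\psi$ iff $\phi\Vdash^P_{\mathscr B}\psi$; for nonempty $\Gamma,\Delta$: $\Vdash^P_{\mathscr B}\Gamma,\Delta$ iff there are $U,V$ with $P=U,V$, $\Vdash^U_{\mathscr B}\Gamma$ and $\Vdash^V_{\mathscr B}\Delta$ (for a singleton $[\phi]$ this is $\Vdash^P_{\mathscr B}\phi$); for nonempty $\Gamma$: $\Gamma\Vdash^P_{\mathscr B}\phi$ iff for every $\mathscr X\supseteq\mathscr B$ and every $U$, if $\Vdash^U_{\mathscr X}\Gamma$ then $\Vdash^{P,U}_{\mathscr X}\phi$. -}

module Defs where

open import Level using (Level; 0ℓ; Lift) renaming (suc to lsuc)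
open import Data.Nat using (ℕ)
open import Data.List using (List; []; _∷_; _++_; concat)
open import Data.Product using (Σ; _×_; _,_; ∃; ∃-syntax)
open import Data.List.Relation.Binary.Permutation.Propositional using (_↭_)

Atom : Set
Atom = ℕ

-- Finite multisets of atoms are represented by lists, taken up to
-- permutation (_↭_); every relation below is permutation-invariant.
AMultiset : Set
AMultiset = List Atom

data Formula : Set where
  atom : Atom → Formula
  _⊗_  : Formula → Formula → Formula
  𝐈    : Formula
  _⊸_  : Formula → Formula → Formula

infixr 6 _⊗_
infixr 5 _⊸_

-- Atomic rule (P₁ ▷ p₁, …, Pₙ ▷ pₙ) ⇒ p : list of premises (Pᵢ , pᵢ) and conclusion p.
Premise : Set
Premise = AMultiset × Atom

record Rule : Set where
  constructor _⇒_
  field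
    premises   : List Premise
    conclusion : Atom

Base : Set₁
Base = Rule → Set

_⊇_ : Base → Base → Set
C ⊇ B = ∀ r → B r → C r

mutual
  data Derives (B : Base) : AMultiset → Atom → Set where
    ax   : ∀ {P p} → P ↭ (p ∷ []) → Derives B P p
    rule : ∀ {Q} (prems : List Premise) (p : Atom) →
           B (prems ⇒ p) →
           (Ss : List AMultiset) →
           DerivesAll B Ss prems →
           Q ↭ concat Ss →
           Derives B Q p

  data DerivesAll (B : Base) : List AMultiset → List Premise → Set where
    []  : DerivesAll B [] []
    _∷_ : ∀ {S P p Ss prems} → Derives B (S ++ P) p →
          DerivesAll B Ss prems → DerivesAll B (S ∷ Ss) ((P , p) ∷ prems)

Supp : Base → AMultiset → Formula → Set₁
Supp B P (atom p) = Lift (lsuc 0ℓ) (Derives B P p)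
Supp B P (φ ⊗ ψ) =
  ∀ (X : Base) → X ⊇ B → ∀ (U : AMultiset) (p : Atom) →
  -- φ , ψ ⊩^U_X p
  (∀ (Y : Base) → Y ⊇ X → ∀ (W : AMultiset) →
     (∃[ W₁ ] ∃[ W₂ ] (W ↭ W₁ ++ W₂ × Supp Y W₁ φ × Supp Y W₂ ψ)) →
     Supp Y (U ++ W) (atom p)) →
  Supp X (P ++ U) (atom p)
Supp B P 𝐈 =
  ∀ (X : Base) → X ⊇ B → ∀ (U : AMultiset) (p : Atom) →
  Supp X U (atom p) → Supp X (P ++ U) (atom p)
Supp B P (φ ⊸ ψ) =
  ∀ (X : Base) → X ⊇ B → ∀ (U : AMultiset) →
  Supp X U φ → Supp X (P ++ U) ψ

syntax Supp B P φ = ⊩[ P ][ B ] φ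

-- Support of 𝐈 at S says precisely that S may be prepended to
-- any atomic support in any extension of the base. The clauses for ⊗ and 𝐈 both
-- end in an atomic support in an extension, so the prefix S is added there; for
-- ⊸ the induction hypothesis is applied in the extension, where 𝐈-support at S
-- persists by monotonicity.
module Submission where

open import Defs
open import Data.List using (_++_)
open import Data.List.Properties using (++-assoc)
open import Relation.Binary.PropositionalEquality using (subst; sym)

⊇-trans : {B C D : Base} → D ⊇ C → C ⊇ B → D ⊇ B
⊇-trans D⊇C C⊇B r b = D⊇C r (C⊇B r b)

⊇-refl : {B : Base} → B ⊇ B
⊇-refl r b = b

Supp-𝐈-mono : {B X : Base} {S : AMultiset} → X ⊇ B → Supp B S 𝐈 → Supp X S 𝐈
Supp-𝐈-mono X⊇B sI Y Y⊇X = sI Y (⊇-trans Y⊇X X⊇B)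

Supp-++-assoc : {B : Base} (S T U : AMultiset) (φ : Formula) →
  Supp B (S ++ (T ++ U)) φ → Supp B ((S ++ T) ++ U) φ
Supp-++-assoc {B} S T U φ = subst (λ P → Supp B P φ) (sym (++-assoc S T U))

lemma1 : (B : Base) (S T : AMultiset) (χ : Formula) →
    Supp B S 𝐈 → Supp B T χ → Supp B (S ++ T) χ
lemma1 B S T (atom p) sI sT = sI B ⊇-refl T p sT
lemma1 B S T (φ ⊗ ψ) sI sT X X⊇B U p h =
  Supp-++-assoc S T U (atom p) (sI X X⊇B (T ++ U) p (sT X X⊇B U p h))
lemma1 B S T 𝐈 sI sT X X⊇B U p k =
  Supp-++-assoc S T U (atom p) (sI X X⊇B (T ++ U) p (sT X X⊇B U p k))
lemma1 B S T (φ ⊸ ψ) sI sT X X⊇B U sφ =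
  Supp-++-assoc S T U ψ (lemma1 X S (T ++ U) ψ (Supp-𝐈-mono X⊇B sI) (sT X X⊇B U sφ))
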